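{- Let $G$ be an infinite group such that $K(G)=\langle a\rangle$ is cyclic with generator $a$. If $\alpha$ is an automorphism of $G$, then $\alpha(\eta(a))=\eta(a)$.
   Context: For $g\in G$, $\eta(g)=\{h\in G: g\notin\langle h\rangle\}$, and $K(G)=\{k\in G: |\eta(k)|<|G|\}$. -}

module Defs where

open import Level using (Level; _⊔_)
open import Algebra.Bundles using (Group)
open import Algebra.Morphism.Structures using (module GroupMorphisms)
open import Data.Nat using (ℕ; zero; suc)
open import Data.Integer using (ℤ; +_; -[1+_])
open import Data.Fin using (Fin)
open import Data.Product using (Σ; ∃; _×_; _,_)
open import Relation.Nullary using (¬_)
open import Relation.Binary.PropositionalEquality using (_≡_)

module _ {c ℓ : Level} (G : Group c ℓ) where
  open Group G

  _^ℕ_ : Carrier → ℕ → Carrier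
  h ^ℕ zero  = ε
  h ^ℕ suc n = h ∙ (h ^ℕ n)

  _^ℤ_ : Carrier → ℤ → Carrier
  h ^ℤ (+ n)    = h ^ℕ n
  h ^ℤ -[1+ n ] = (h ^ℕ suc n) ⁻¹

  _∈⟨_⟩ : Carrier → Carrier → Set ℓ
  g ∈⟨ h ⟩ = ∃ λ (z : ℤ) → g ≈ (h ^ℤ z)

  _∈η_ : Carrier → Carrier → Set ℓ
  h ∈η g = ¬ (g ∈⟨ h ⟩)

  -- η(g) as a subset type (setoid equality inherited from G)
  η : Carrier → Set (c ⊔ ℓ)
  η g = Σ Carrier λ h → h ∈η g

  -- |η(g)| ≤ |G|: an injection η(g) → G (respecting the setoid equalities)
  CardLeηG : Carrier → Set (c ⊔ ℓ)
  CardLeηG g = Σ (η g → Carrier) λ f →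
      (∀ (x y : η g) → Σ.proj₁ x ≈ Σ.proj₁ y → f x ≈ f y)
    × (∀ (x y : η g) → f x ≈ f y → Σ.proj₁ x ≈ Σ.proj₁ y)

  -- |G| ≤ |η(g)|: an injection G → η(g)
  CardLeGη : Carrier → Set (c ⊔ ℓ)
  CardLeGη g = Σ (Carrier → η g) λ f →
      (∀ x y → x ≈ y → Σ.proj₁ (f x) ≈ Σ.proj₁ (f y))
    × (∀ x y → Σ.proj₁ (f x) ≈ Σ.proj₁ (f y) → x ≈ y)

  CardLtηG : Carrier → Set (c ⊔ ℓ)
  CardLtηG g = CardLeηG g × ¬ CardLeGη g

  _∈K : Carrier → Set (c ⊔ ℓ)
  k ∈K = CardLtηG k

  Finite : Set (c ⊔ ℓ)
  Finite = ∃ λ (n : ℕ) → Σ (Fin n → Carrier) λ f →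
      (∀ i j → f i ≈ f j → i ≡ j) × (∀ g → ∃ λ i → f i ≈ g)

  Infinite : Set (c ⊔ ℓ)
  Infinite = ¬ Finite

  IsAutomorphism : (Carrier → Carrier) → Set (c ⊔ ℓ)
  IsAutomorphism α = GroupMorphisms.IsGroupIsomorphism rawGroup rawGroup α

module Submission where

-- Let K(G) = ⟨a⟩ and let α be an automorphism of G, with inverse β.
--
-- Membership x ∈ ⟨h⟩ respects equality, contains h,
--    and is transitive (x ∈ ⟨g⟩ and g ∈ ⟨h⟩ give x ∈ ⟨h⟩), because ⟨h⟩ is
--    closed under inverses and natural powers.  Hence η is antitone:
--    k ∈ ⟨k'⟩ implies η(k) ⊆ η(k').
-- 2. Comparing η-sets.  An injection mapping η(k') into η(k) turns
--    |η(k)| < |G| into |η(k')| < |G|, i.e. k ∈ K(G) gives k' ∈ K(G).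
-- 3. Automorphisms.  α preserves powers, so x ∈ ⟨h⟩ ⇔ α x ∈ ⟨α h⟩ and
--    h ∈ η(k) ⇔ α h ∈ η(α k).  By step 2 (with β, resp. α, as injection)
--    k ∈ K(G) ⇔ α k ∈ K(G).
-- 4. Since a ∈ K(G), also α a ∈ K(G) = ⟨a⟩; since α(β a) ≈ a ∈ K(G), also
--    β a ∈ ⟨a⟩, hence a ∈ ⟨α a⟩.  So ⟨α a⟩ = ⟨a⟩, thus η(α a) = η(a), and
--    α maps η(a) onto η(α a) = η(a).

open import Level using (Level; _⊔_)
open import Algebra.Bundles using (Group)
open import Data.Product using (∃; _×_; _,_; proj₁; proj₂)
open import Data.Nat using (ℕ; zero; suc) renaming (_*_ to _*ℕ_)
open import Data.Integer using (ℤ; +_; -[1+_])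
import Algebra.Properties.Group as GroupProperties
import Algebra.Properties.Monoid.Mult as MonoidMult
import Relation.Binary.Reasoning.Setoid as SetoidReasoning
open import Function using (_∘_)
open import Algebra.Morphism.Structures using (module GroupMorphisms)
import Defs as D

module Cyclic {c ℓ : Level} (G : Group c ℓ) where
  open Group G
  open GroupProperties G using (ε⁻¹≈ε; ⁻¹-involutive; ⁻¹-anti-homo-∙)
  open MonoidMult monoid using (×-congʳ; ×-assocˡ) renaming (_×_ to _·_)
  open SetoidReasoning setoid

  infixr 8 _^_ _^ᶻ_
  infix 4 _∈⟨_⟩ _∈η_ _∈K

  _^_ : Carrier → ℕ → Carrier
  _^_ = D._^ℕ_ G

  _^ᶻ_ : Carrier → ℤ → Carrier
  _^ᶻ_ = D._^ℤ_ G

  _∈⟨_⟩ : Carrier → Carrier → Set ℓ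
  _∈⟨_⟩ = D._∈⟨_⟩ G

  _∈η_ : Carrier → Carrier → Set ℓ
  _∈η_ = D._∈η_ G

  _∈K : Carrier → Set (c ⊔ ℓ)
  _∈K = D._∈K G

  ^≈· : ∀ h n → h ^ n ≈ n · h
  ^≈· h zero    = refl
  ^≈· h (suc n) = ∙-congˡ (^≈· h n)

  ^-cong : ∀ {x y} n → x ≈ y → x ^ n ≈ y ^ n
  ^-cong zero    x≈y = refl
  ^-cong (suc n) x≈y = ∙-cong x≈y (^-cong n x≈y)

  ^-^ : ∀ h m n → (h ^ m) ^ n ≈ h ^ (n *ℕ m)
  ^-^ h m n = begin
    (h ^ m) ^ n    ≈⟨ ^≈· (h ^ m) n ⟩
    n · (h ^ m)    ≈⟨ ×-congʳ n (^≈· h m) ⟩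
    n · (m · h)    ≈⟨ ×-assocˡ h n m ⟩
    (n *ℕ m) · h   ≈⟨ ^≈· h (n *ℕ m) ⟨
    h ^ (n *ℕ m)   ∎

  ^-comm : ∀ h n → h ∙ h ^ n ≈ h ^ n ∙ h
  ^-comm h zero    = trans (identityʳ h) (sym (identityˡ h))
  ^-comm h (suc n) = trans (∙-congˡ (^-comm h n)) (sym (assoc h (h ^ n) h))

  ⁻¹-^ : ∀ h n → (h ⁻¹) ^ n ≈ (h ^ n) ⁻¹
  ⁻¹-^ h zero    = sym ε⁻¹≈ε
  ⁻¹-^ h (suc n) = begin
    h ⁻¹ ∙ (h ⁻¹) ^ n    ≈⟨ ∙-congˡ (⁻¹-^ h n) ⟩
    h ⁻¹ ∙ (h ^ n) ⁻¹    ≈⟨ ⁻¹-anti-homo-∙ (h ^ n) h ⟨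
    (h ^ n ∙ h) ⁻¹       ≈⟨ ⁻¹-cong (^-comm h n) ⟨
    (h ∙ h ^ n) ⁻¹       ∎

  ^ᶻ-cong : ∀ {x y} z → x ≈ y → x ^ᶻ z ≈ y ^ᶻ z
  ^ᶻ-cong (+ n)    x≈y = ^-cong n x≈y
  ^ᶻ-cong -[1+ n ] x≈y = ⁻¹-cong (^-cong (suc n) x≈y)

  ∈⟨⟩-resp : ∀ {x x' h h'} → x ≈ x' → h ≈ h' → x ∈⟨ h ⟩ → x' ∈⟨ h' ⟩
  ∈⟨⟩-resp x≈x' h≈h' (z , x≈hᶻ) = z , trans (sym x≈x') (trans x≈hᶻ (^ᶻ-cong z h≈h'))

  ∈⟨⟩-refl : ∀ h → h ∈⟨ h ⟩
  ∈⟨⟩-refl h = + 1 , sym (identityʳ h)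

  ∈⟨⟩-⁻¹ : ∀ {x h} → x ∈⟨ h ⟩ → x ⁻¹ ∈⟨ h ⟩
  ∈⟨⟩-⁻¹ (+ zero , x≈ε)          = + 0 , trans (⁻¹-cong x≈ε) ε⁻¹≈ε
  ∈⟨⟩-⁻¹ (+ suc n , x≈hⁿ)        = -[1+ n ] , ⁻¹-cong x≈hⁿ
  ∈⟨⟩-⁻¹ {h = h} (-[1+ n ] , x≈h⁻ⁿ) =
    + suc n , trans (⁻¹-cong x≈h⁻ⁿ) (⁻¹-involutive (h ^ suc n))

  ∈⟨⟩-^ : ∀ {x h} → x ∈⟨ h ⟩ → ∀ n → x ^ n ∈⟨ h ⟩
  ∈⟨⟩-^ {h = h} (+ m , x≈hᵐ) n = + (n *ℕ m) , trans (^-cong n x≈hᵐ) (^-^ h m n)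
  ∈⟨⟩-^ {h = h} (-[1+ m ] , x≈h⁻ᵐ) n =
    ∈⟨⟩-resp (sym (trans (^-cong n x≈h⁻ᵐ) (⁻¹-^ (h ^ suc m) n))) refl
      (∈⟨⟩-⁻¹ (∈⟨⟩-^ (+ suc m , refl) n))

  ∈⟨⟩-trans : ∀ {x g h} → x ∈⟨ g ⟩ → g ∈⟨ h ⟩ → x ∈⟨ h ⟩
  ∈⟨⟩-trans (+ n , x≈gⁿ)      g∈⟨h⟩ = ∈⟨⟩-resp (sym x≈gⁿ) refl (∈⟨⟩-^ g∈⟨h⟩ n)
  ∈⟨⟩-trans (-[1+ n ] , x≈g⁻ⁿ) g∈⟨h⟩ =
    ∈⟨⟩-resp (sym x≈g⁻ⁿ) refl (∈⟨⟩-⁻¹ (∈⟨⟩-^ g∈⟨h⟩ (suc n)))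

  η-resp : ∀ {h h' k} → h ≈ h' → h ∈η k → h' ∈η k
  η-resp h≈h' h∈ηk k∈⟨h'⟩ = h∈ηk (∈⟨⟩-resp refl (sym h≈h') k∈⟨h'⟩)

  η-antitone : ∀ {h k k'} → k ∈⟨ k' ⟩ → h ∈η k → h ∈η k'
  η-antitone k∈⟨k'⟩ h∈ηk k'∈⟨h⟩ = h∈ηk (∈⟨⟩-trans k∈⟨k'⟩ k'∈⟨h⟩)

  -- If an injection ψ of G maps η(k') into η(k), then |η(k')| ≤ |η(k)|,
  -- so k ∈ K(G) forces k' ∈ K(G).
  K-transfer : ∀ {k k'} (ψ : Carrier → Carrier)
    → (∀ {x y} → x ≈ y → ψ x ≈ ψ y)
    → (∀ {x y} → ψ x ≈ ψ y → x ≈ y)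
    → (∀ {h} → h ∈η k' → ψ h ∈η k)
    → k ∈K → k' ∈K
  K-transfer {k} {k'} ψ ψ-cong ψ-inj ψ-η ((f , f-cong , f-inj) , G↛ηk) =
    (f ∘ restrict , (λ _ _ e → f-cong _ _ (ψ-cong e)) , λ _ _ e → ψ-inj (f-inj _ _ e))
    , λ (g , g-cong , g-inj) →
        G↛ηk (restrict ∘ g , (λ x y e → ψ-cong (g-cong x y e)) , λ x y e → g-inj x y (ψ-inj e))
    where
    restrict : D.η G k' → D.η G k
    restrict (h , h∈ηk') = ψ h , ψ-η h∈ηk'

module Automorphism {c ℓ : Level} (G : Group c ℓ)
    (α : Group.Carrier G → Group.Carrier G) (α-iso : D.IsAutomorphism G α) where
  open Group G
  open Cyclic G
  open GroupMorphisms.IsGroupIsomorphism α-iso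

  α-^ : ∀ h n → α (h ^ n) ≈ α h ^ n
  α-^ h zero    = ε-homo
  α-^ h (suc n) = trans (∙-homo h (h ^ n)) (∙-congˡ (α-^ h n))

  α-^ᶻ : ∀ h z → α (h ^ᶻ z) ≈ α h ^ᶻ z
  α-^ᶻ h (+ n)    = α-^ h n
  α-^ᶻ h -[1+ n ] = trans (⁻¹-homo (h ^ suc n)) (⁻¹-cong (α-^ h (suc n)))

  ∈⟨⟩-image : ∀ {x h} → x ∈⟨ h ⟩ → α x ∈⟨ α h ⟩
  ∈⟨⟩-image {h = h} (z , x≈hᶻ) = z , trans (⟦⟧-cong x≈hᶻ) (α-^ᶻ h z)

  ∈⟨⟩-preimage : ∀ {x h} → α x ∈⟨ α h ⟩ → x ∈⟨ h ⟩
  ∈⟨⟩-preimage {h = h} (z , αx≈αhᶻ) = z , injective (trans αx≈αhᶻ (sym (α-^ᶻ h z)))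

  η-image : ∀ {h k} → h ∈η k → α h ∈η α k
  η-image h∈ηk αk∈⟨αh⟩ = h∈ηk (∈⟨⟩-preimage αk∈⟨αh⟩)

  η-preimage : ∀ {h k} → α h ∈η α k → h ∈η k
  η-preimage αh∈ηαk k∈⟨h⟩ = αh∈ηαk (∈⟨⟩-image k∈⟨h⟩)

  β : Carrier → Carrier
  β y = proj₁ (surjective y)

  α-β : ∀ y → α (β y) ≈ y
  α-β y = proj₂ (surjective y) refl

  β-cong : ∀ {x y} → x ≈ y → β x ≈ β y
  β-cong {x} {y} x≈y = injective (trans (α-β x) (trans x≈y (sym (α-β y))))

  β-injective : ∀ {x y} → β x ≈ β y → x ≈ y
  β-injective {x} {y} βx≈βy = trans (sym (α-β x)) (trans (⟦⟧-cong βx≈βy) (α-β y))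

  η-β : ∀ {h k} → h ∈η α k → β h ∈η k
  η-β {h} h∈ηαk = η-preimage (η-resp (sym (α-β h)) h∈ηαk)

  K-image : ∀ {k} → k ∈K → α k ∈K
  K-image = K-transfer β β-cong β-injective η-β

  K-preimage : ∀ {k} → α k ∈K → k ∈K
  K-preimage = K-transfer α ⟦⟧-cong injective η-image

  module _ (a : Carrier) (K≡⟨a⟩ : ∀ k → (k ∈K → k ∈⟨ a ⟩) × (k ∈⟨ a ⟩ → k ∈K)) where
    a∈K : a ∈K
    a∈K = proj₂ (K≡⟨a⟩ a) (∈⟨⟩-refl a)

    αa∈⟨a⟩ : α a ∈⟨ a ⟩
    αa∈⟨a⟩ = proj₁ (K≡⟨a⟩ (α a)) (K-image a∈K)

    a∈⟨αa⟩ : a ∈⟨ α a ⟩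
    a∈⟨αa⟩ = ∈⟨⟩-resp (α-β a) refl (∈⟨⟩-image βa∈⟨a⟩)
      where
      αβa∈K : α (β a) ∈K
      αβa∈K = proj₂ (K≡⟨a⟩ (α (β a))) (∈⟨⟩-resp (sym (α-β a)) refl (∈⟨⟩-refl a))
      βa∈⟨a⟩ : β a ∈⟨ a ⟩
      βa∈⟨a⟩ = proj₁ (K≡⟨a⟩ (β a)) (K-preimage αβa∈K)

open D

lemma3p3 : {c ℓ : Level} (G : Group c ℓ) → Infinite G → (a : Group.Carrier G)
    → (∀ k → (_∈K G k → _∈⟨_⟩ G k a) × (_∈⟨_⟩ G k a → _∈K G k))
    → (α : Group.Carrier G → Group.Carrier G) → IsAutomorphism G α
    → ∀ y → ((∃ λ h → _∈η_ G h a × Group._≈_ G (α h) y) → _∈η_ G y a)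
    × (_∈η_ G y a → ∃ λ h → _∈η_ G h a × Group._≈_ G (α h) y)
lemma3p3 G _ a K≡⟨a⟩ α α-iso y = image⊆η , η⊆image
  where
  open Cyclic G using (η-resp; η-antitone)
  open Automorphism G α α-iso

  -- α(η(a)) ⊆ η(α a) ⊆ η(a), using α a ∈ ⟨a⟩.
  image⊆η : (∃ λ h → _∈η_ G h a × Group._≈_ G (α h) y) → _∈η_ G y a
  image⊆η (h , h∈ηa , αh≈y) =
    η-antitone (αa∈⟨a⟩ a K≡⟨a⟩) (η-resp αh≈y (η-image h∈ηa))

  -- η(a) ⊆ η(α a), using a ∈ ⟨α a⟩, and β maps η(α a) into η(a).
  η⊆image : _∈η_ G y a → ∃ λ h → _∈η_ G h a × Group._≈_ G (α h) y
  η⊆image y∈ηa = β y , η-β (η-antitone (a∈⟨αa⟩ a K≡⟨a⟩) y∈ηa) , α-β y
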